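{- Let $\mathcal{P}=\mathrm{tconv}(v^1,\ldots,v^s)\subset\mathbb{R}^e/\mathbb{R}\mathbf{1}$ with $s\ge2$ and $V=\{v^1,\ldots,v^s\}$. Call a move from $x\in\mathcal{P}$ to $y$ admissible if there is a nonempty proper subset $U\subsetneq V$ with $y$ on the tropical line segment $\Gamma_{\pi_{\mathrm{tconv}(U)}(x),\,\pi_{\mathrm{tconv}(V\setminus U)}(x)}$ (these are exactly the moves that the vertex HAR sampler with extrapolation and random vertex subsets can make). Then any two points $u,v\in\mathcal{P}$ are connected via this algorithm, i.e. there is a finite sequence $u=x_0,\ldots,x_n=v$ in $\mathcal{P}$ in which each move $x_k\to x_{k+1}$ is admissible.
   Context: $\mathbb{R}^e/\mathbb{R}\mathbf{1}$ is the tropical projective torus. Tropical operations: $a\oplus b=\max(a,b)$, $a\odot b=a+b$, coordinatewise on vectors. For a finite set $W=\{w^1,\ldots,w^t\}$, $\mathrm{tconv}(W)=\{a_1\odot w^1\oplus\cdots\oplus a_t\odot w^t:a_l\in\mathbb{R}\}$ and $\pi_{\mathrm{tconv}(W)}(x)=\bigoplus_{l=1}^t\min(x-w^l)\odot w^l$, with $\min(y)$ the smallest coordinate of $y$. $\Gamma_{a,b}=\mathrm{tconv}(a,b)$. -}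

module Defs where

open import Level using (0ℓ)
open import Data.Nat using (ℕ; zero; suc)
open import Data.Fin using (Fin; zero; suc)
open import Data.Bool using (Bool; true; false; not; if_then_else_)
open import Data.List using (List; foldr; allFin)
open import Data.Product using (Σ; ∃; _×_; _,_)
open import Relation.Nullary using (¬_; Dec; yes; no)
open import Relation.Binary.PropositionalEquality using (_≡_)
open import Algebra.Structures using (IsCommutativeRing)
open import Relation.Binary.Structures using (IsDecTotalOrder)
open import Function using (_∘_)

-- An axiomatisation of the real numbers: a complete ordered field
-- (all models are isomorphic to ℝ).  The standard library has no reals.
record RealLine : Set₁ where
  infixl 6 _+_
  infixl 7 _*_
  field
    R    : Set
    _+_  : R → R → R
    _*_  : R → R → R
    -_   : R → R
    0r   : R
    1r   : R
    _≤_  : R → R → Set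
    isCommutativeRing : IsCommutativeRing _≡_ _+_ _*_ -_ 0r 1r
    isDecTotalOrder   : IsDecTotalOrder _≡_ _≤_
    0≢1   : ¬ (0r ≡ 1r)
    inv   : ∀ x → ¬ (x ≡ 0r) → Σ R (λ y → x * y ≡ 1r)
    +-mono-≤ : ∀ {a b} c → a ≤ b → (a + c) ≤ (b + c)
    *-nonneg : ∀ {a b} → 0r ≤ a → 0r ≤ b → 0r ≤ (a * b)
    sup : (P : R → Set) → ∃ P → ∃ (λ b → ∀ x → P x → x ≤ b) →
          ∃ (λ m → (∀ x → P x → x ≤ m) × (∀ b → (∀ x → P x → x ≤ b) → m ≤ b))

module Tropical (ℝ : RealLine) where
  open RealLine ℝ public
  open IsDecTotalOrder isDecTotalOrder using (_≤?_)

  max : R → R → R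
  max a b with a ≤? b
  ... | yes _ = b
  ... | no  _ = a

  min : R → R → R
  min a b with a ≤? b
  ... | yes _ = a
  ... | no  _ = b

  -- representatives of points of ℝ^e / ℝ1, with e = suc d
  Pt : ℕ → Set
  Pt d = Fin (suc d) → R

  _~_ : ∀ {d} → Pt d → Pt d → Set
  x ~ y = ∃ λ c → ∀ i → x i ≡ y i + c

  minF : ∀ {n} → (Fin (suc n) → R) → R
  minF {zero}  f = f zero
  minF {suc n} f = min (f zero) (minF (f ∘ suc))

  _⊕_ : ∀ {d} → Pt d → Pt d → Pt d
  (x ⊕ y) i = max (x i) (y i)

  _⊙_ : ∀ {d} → R → Pt d → Pt d
  (c ⊙ x) i = c + x i

  _-ᵖ_ : ∀ {d} → Pt d → Pt d → Pt d
  (x -ᵖ y) i = x i + - y i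

  tcomb : ∀ {d n} → (Fin (suc n) → R) → (Fin (suc n) → Pt d) → Pt d
  tcomb {n = zero}  a w = a zero ⊙ w zero
  tcomb {n = suc n} a w = (a zero ⊙ w zero) ⊕ tcomb (a ∘ suc) (w ∘ suc)

  InTconv : ∀ {d n} → (Fin (suc n) → Pt d) → Pt d → Set
  InTconv w x = ∃ λ a → x ~ tcomb a w

  pair : ∀ {d} → Pt d → Pt d → Fin 2 → Pt d
  pair a b zero    = a
  pair a b (suc _) = b

  InΓ : ∀ {d} → Pt d → Pt d → Pt d → Set
  InΓ a b y = InTconv (pair a b) y

  -- π_{tconv(U)}(x) = ⊕_{l ∈ U} min(x - v^l) ⊙ v^l, for the nonempty index
  -- subset U (a Boolean mask); l0 ∈ U is a witness of nonemptiness, used as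
  -- the starting term of the (idempotent) tropical sum.
  projTerm : ∀ {d s} → (Fin s → Pt d) → Pt d → Fin s → Pt d
  projTerm v x l = minF (x -ᵖ v l) ⊙ v l

  proj : ∀ {d s} → (Fin s → Pt d) → (Fin s → Bool) → Fin s → Pt d → Pt d
  proj {s = s} v U l0 x =
    foldr (λ l acc → if U l then acc ⊕ projTerm v x l else acc)
          (projTerm v x l0) (allFin s)

  Admissible : ∀ {d s} → (Fin s → Pt d) → Pt d → Pt d → Set
  Admissible v x y =
    Σ (Fin _ → Bool) λ U → Σ (Fin _) λ l0 → Σ (Fin _) λ l1 →
      (U l0 ≡ true) × (U l1 ≡ false) ×
      InΓ (proj v U l0 x) (proj v (not ∘ U) l1 x) y

  -- finite sequence x = x_0, ..., x_n = z of admissible moves, each x_{k+1} ∈ P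
  -- (x_0 ∈ P is assumed separately)
  data Path {d k} (v : Fin (suc (suc k)) → Pt d) : Pt d → Pt d → Set where
    done : ∀ {x} → Path v x x
    step : ∀ {x y z} → Admissible v x y → InTconv v y → Path v y z → Path v x z

{-# OPTIONS --safe #-}
-- Shift the coefficients of w = ⨁ a l ⊙ v l by a common constant to get a representative
-- z = ⨁ T l ⊙ v l of w with u ≤ z coordinatewise.  Then sweep through the vertices: the move
-- with U = {j} replaces x by T j ⊙ v j ⊕ ⨁_{l ≠ j} min(x - v l) ⊙ v l.  It keeps x ≤ z, since
-- min(x - v l) ⊙ v l ≤ x, and it keeps every term T m ⊙ v m that is already below x below the
-- new point, since then T m ≤ min(x - v m).  After every vertex has been visited, all terms of z
-- lie below x, so x = z.  Every point of Γ between π_tconv(U)(x) and π_tconv(V∖U)(x) is a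
-- tropical combination of the vertices, so all moves stay in P.
module Submission where

open import Level using (0ℓ)
open import Data.Nat using (ℕ; suc)
open import Data.Fin using (Fin; zero; suc; _≟_)
open import Data.Bool using (Bool; true; false; not; if_then_else_)
open import Data.List using (List; []; _∷_; foldr; allFin)
open import Data.List.Membership.Propositional using (_∈_)
open import Data.List.Membership.Propositional.Properties using (∈-allFin)
open import Data.List.Relation.Unary.Any using (here; there)
open import Data.Product using (Σ; _×_; _,_)
open import Data.Sum using (_⊎_; inj₁; inj₂)
open import Data.Unit using (⊤; tt)
open import Relation.Nullary using (¬_; yes; no; does; contradiction)
open import Relation.Nullary.Decidable using (dec-true; dec-false)
open import Relation.Binary.PropositionalEquality
  using (_≡_; refl; sym; trans; cong; subst; module ≡-Reasoning)
open import Relation.Binary.Bundles using (DecTotalOrder)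
open import Algebra.Bundles using (CommutativeRing)
open import Algebra.Construct.NaturalChoice.Base using (MinOperator; MaxOperator)
import Algebra.Construct.NaturalChoice.MinOp as MinOp
import Algebra.Construct.NaturalChoice.MaxOp as MaxOp
import Algebra.Properties.Group as GroupProperties
import Relation.Binary.Reasoning.PartialOrder as PosetReasoning
open import Function using (_∘_; case_of_)
open import Defs

module _ (ℝ : RealLine) where
  open Tropical ℝ renaming (_≤_ to infix 4 _≤_)

  decTotalOrder : DecTotalOrder 0ℓ 0ℓ 0ℓ
  decTotalOrder = record { isDecTotalOrder = isDecTotalOrder }

  open DecTotalOrder decTotalOrder
    using (_≤?_; antisym; totalPreorder; poset) renaming (refl to ≤-refl; trans to ≤-trans)
  module ≤-Reasoning = PosetReasoning poset

  commutativeRing : CommutativeRing 0ℓ 0ℓ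
  commutativeRing = record { isCommutativeRing = isCommutativeRing }

  open CommutativeRing commutativeRing using (+-assoc; +-comm; +-identityˡ; +-identityʳ; +-group)
  open GroupProperties +-group using (\\-leftDividesˡ; //-rightDividesˡ; //-rightDividesʳ)

  +-monoʳ-≤ : ∀ c {a b} → a ≤ b → c + a ≤ c + b
  +-monoʳ-≤ c {a} {b} a≤b =
    subst (_≤ c + b) (+-comm a c) (subst (a + c ≤_) (+-comm b c) (+-mono-≤ c a≤b))

  a+c≤b⇒a≤b-c : ∀ {a b c} → a + c ≤ b → a ≤ b + - c
  a+c≤b⇒a≤b-c {a} {b} {c} a+c≤b = begin
    a               ≡⟨ //-rightDividesʳ c a ⟨
    (a + c) + - c   ≤⟨ +-mono-≤ (- c) a+c≤b ⟩
    b + - c         ∎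
    where open ≤-Reasoning

  a≤b-c⇒a+c≤b : ∀ {a b c} → a ≤ b + - c → a + c ≤ b
  a≤b-c⇒a+c≤b {a} {b} {c} a≤b-c = begin
    a + c            ≤⟨ +-mono-≤ c a≤b-c ⟩
    (b + - c) + c    ≡⟨ //-rightDividesˡ c b ⟩
    b                ∎
    where open ≤-Reasoning

  max-of-≤ : ∀ {a b} → a ≤ b → max a b ≡ b
  max-of-≤ {a} {b} a≤b with a ≤? b
  ... | yes _   = refl
  ... | no  a≰b = contradiction a≤b a≰b

  max-of-≥ : ∀ {a b} → b ≤ a → max a b ≡ a
  max-of-≥ {a} {b} b≤a with a ≤? b
  ... | yes a≤b = antisym b≤a a≤b
  ... | no  _   = refl

  min-of-≤ : ∀ {a b} → a ≤ b → min a b ≡ a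
  min-of-≤ {a} {b} a≤b with a ≤? b
  ... | yes _   = refl
  ... | no  a≰b = contradiction a≤b a≰b

  min-of-≥ : ∀ {a b} → b ≤ a → min a b ≡ b
  min-of-≥ {a} {b} b≤a with a ≤? b
  ... | yes a≤b = antisym a≤b b≤a
  ... | no  _   = refl

  maxOperator : MaxOperator totalPreorder
  maxOperator = record { _⊔_ = max ; x≤y⇒x⊔y≈y = max-of-≤ ; x≥y⇒x⊔y≈x = max-of-≥ }

  minOperator : MinOperator totalPreorder
  minOperator = record { _⊓_ = min ; x≤y⇒x⊓y≈x = min-of-≤ ; x≥y⇒x⊓y≈y = min-of-≥ }

  open MaxOp maxOperator using (x≤x⊔y; x≤y⊔x; ⊔-lub)
  open MinOp minOperator using (x⊓y≤x; x⊓y≤y; ⊓-glb)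

  minF-≤ : ∀ {n} (f : Fin (suc n) → R) i → minF f ≤ f i
  minF-≤ {ℕ.zero} f zero    = ≤-refl
  minF-≤ {suc n}  f zero    = x⊓y≤x _ _
  minF-≤ {suc n}  f (suc i) = ≤-trans (x⊓y≤y _ _) (minF-≤ (f ∘ suc) i)

  ≤-minF : ∀ {n} (f : Fin (suc n) → R) {c} → (∀ i → c ≤ f i) → c ≤ minF f
  ≤-minF {ℕ.zero} f c≤f = c≤f zero
  ≤-minF {suc n}  f c≤f = ⊓-glb (c≤f zero) (≤-minF (f ∘ suc) (c≤f ∘ suc))

  maxF : ∀ {n} → (Fin (suc n) → R) → R
  maxF {ℕ.zero} f = f zero
  maxF {suc n}  f = max (f zero) (maxF (f ∘ suc))

  ≤-maxF : ∀ {n} (f : Fin (suc n) → R) i → f i ≤ maxF f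
  ≤-maxF {ℕ.zero} f zero    = ≤-refl
  ≤-maxF {suc n}  f zero    = x≤x⊔y _ _
  ≤-maxF {suc n}  f (suc i) = ≤-trans (≤-maxF (f ∘ suc) i) (x≤y⊔x _ _)

  record IsLub {s} (S : Fin s → Set) (f : Fin s → R) (r : R) : Set where
    field
      upper : ∀ l → S l → f l ≤ r
      least : ∀ B → (∀ l → S l → f l ≤ B) → r ≤ B
  open IsLub

  IsLub-unique : ∀ {s S f r r'} → IsLub {s} S f r → IsLub S f r' → r ≡ r'
  IsLub-unique r-lub r'-lub = antisym (least r-lub _ (upper r'-lub)) (least r'-lub _ (upper r-lub))

  IsLub-cong : ∀ {s S f g r} → (∀ l → S l → f l ≡ g l) → IsLub {s} S f r → IsLub S g r
  IsLub-cong f≡g r-lub = record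
    { upper = λ l l∈S → subst (_≤ _) (f≡g l l∈S) (upper r-lub l l∈S)
    ; least = λ B g≤B → least r-lub B (λ l l∈S → subst (_≤ B) (sym (f≡g l l∈S)) (g≤B l l∈S))
    }

  IsLub-resp-⇔ : ∀ {s S S' f r} → (∀ l → S l → S' l) → (∀ l → S' l → S l) →
                 IsLub {s} S f r → IsLub S' f r
  IsLub-resp-⇔ S⊆S' S'⊆S r-lub = record
    { upper = λ l l∈S' → upper r-lub l (S'⊆S l l∈S')
    ; least = λ B f≤B → least r-lub B (λ l l∈S → f≤B l (S⊆S' l l∈S))
    }

  IsLub-+ˡ : ∀ {s S f r} c → IsLub {s} S f r → IsLub S (λ l → c + f l) (c + r)
  IsLub-+ˡ {f = f} {r} c r-lub = record
    { upper = λ l l∈S → +-monoʳ-≤ c (upper r-lub l l∈S)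
    ; least = λ B c+f≤B →
        subst (_≤ B) (+-comm r c) (a≤b-c⇒a+c≤b (least r-lub _ (λ l l∈S →
          a+c≤b⇒a≤b-c (subst (_≤ B) (+-comm c (f l)) (c+f≤B l l∈S)))))
    }

  IsLub-max : ∀ {s S S' f r r'} → IsLub {s} S f r → IsLub S' f r' →
              IsLub (λ l → S l ⊎ S' l) f (max r r')
  IsLub-max r-lub r'-lub = record
    { upper = λ { l (inj₁ l∈S)  → ≤-trans (upper r-lub l l∈S) (x≤x⊔y _ _)
                ; l (inj₂ l∈S') → ≤-trans (upper r'-lub l l∈S') (x≤y⊔x _ _) }
    ; least = λ B f≤B →
        ⊔-lub (least r-lub B (λ l → f≤B l ∘ inj₁)) (least r'-lub B (λ l → f≤B l ∘ inj₂))
    }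

  tcomb-isLub : ∀ {d n} (a : Fin (suc n) → R) (w : Fin (suc n) → Pt d) i →
                IsLub (λ _ → ⊤) (λ l → a l + w l i) (tcomb a w i)
  tcomb-isLub {n = ℕ.zero} a w i = record
    { upper = λ { zero _ → ≤-refl }
    ; least = λ B a+w≤B → a+w≤B zero tt
    }
  tcomb-isLub {n = suc n} a w i = record
    { upper = λ { zero _ → x≤x⊔y _ _ ; (suc l) _ → ≤-trans (upper tail l tt) (x≤y⊔x _ _) }
    ; least = λ B a+w≤B → ⊔-lub (a+w≤B zero tt) (least tail B (λ l _ → a+w≤B (suc l) tt))
    }
    where
      tail : IsLub (λ _ → ⊤) (λ l → a (suc l) + w (suc l) i) (tcomb (a ∘ suc) (w ∘ suc) i)
      tail = tcomb-isLub (a ∘ suc) (w ∘ suc) i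

  tcomb-⊙ : ∀ {d n} c (a : Fin (suc n) → R) (w : Fin (suc n) → Pt d) i →
            tcomb (λ l → c + a l) w i ≡ c + tcomb a w i
  tcomb-⊙ c a w i = IsLub-unique (tcomb-isLub (λ l → c + a l) w i)
    (IsLub-cong (λ l _ → sym (+-assoc c (a l) (w l i))) (IsLub-+ˡ c (tcomb-isLub a w i)))

  projCoeff : ∀ {d s} → (Fin s → Pt d) → Pt d → Fin s → R
  projCoeff v x l = minF (x -ᵖ v l)

  projCoeff-+-≤ : ∀ {d s} (v : Fin s → Pt d) x l i → projCoeff v x l + v l i ≤ x i
  projCoeff-+-≤ v x l i = a≤b-c⇒a+c≤b (minF-≤ (x -ᵖ v l) i)

  ≤-projCoeff : ∀ {d s} (v : Fin s → Pt d) x l {c} →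
                (∀ i → c + v l i ≤ x i) → c ≤ projCoeff v x l
  ≤-projCoeff v x l c+v≤x = ≤-minF (x -ᵖ v l) (a+c≤b⇒a≤b-c ∘ c+v≤x)

  FoldSupport : ∀ {s} → (Fin s → Bool) → Fin s → List (Fin s) → Fin s → Set
  FoldSupport U l0 ls l = l ≡ l0 ⊎ (l ∈ ls × U l ≡ true)

  proj-foldr-isLub : ∀ {d s} (v : Fin s → Pt d) (U : Fin s → Bool) l0 x i (ls : List (Fin s)) →
    IsLub (FoldSupport U l0 ls) (λ l → projCoeff v x l + v l i)
          (foldr (λ l acc → if U l then acc ⊕ projTerm v x l else acc) (projTerm v x l0) ls i)
  proj-foldr-isLub v U l0 x i [] = record
    { upper = λ { l (inj₁ refl) → ≤-refl ; l (inj₂ (() , _)) }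
    ; least = λ B f≤B → f≤B l0 (inj₁ refl)
    }
  proj-foldr-isLub v U l0 x i (l' ∷ ls) with U l' in Ul'
  ... | true  = IsLub-resp-⇔ to from (IsLub-max (proj-foldr-isLub v U l0 x i ls) single)
    where
      single : IsLub (_≡ l') (λ l → projCoeff v x l + v l i) (projCoeff v x l' + v l' i)
      single = record { upper = λ { l refl → ≤-refl } ; least = λ B f≤B → f≤B l' refl }
      to : ∀ l → FoldSupport U l0 ls l ⊎ l ≡ l' → FoldSupport U l0 (l' ∷ ls) l
      to = λ { l (inj₁ (inj₁ e)) → inj₁ e ; l (inj₁ (inj₂ (p , u))) → inj₂ (there p , u)
             ; l (inj₂ refl) → inj₂ (here refl , Ul') }
      from : ∀ l → FoldSupport U l0 (l' ∷ ls) l → FoldSupport U l0 ls l ⊎ l ≡ l'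
      from = λ { l (inj₁ e) → inj₁ (inj₁ e) ; l (inj₂ (here refl , _)) → inj₂ refl
               ; l (inj₂ (there p , u)) → inj₁ (inj₂ (p , u)) }
  ... | false = IsLub-resp-⇔ to from (proj-foldr-isLub v U l0 x i ls)
    where
      to : ∀ l → FoldSupport U l0 ls l → FoldSupport U l0 (l' ∷ ls) l
      to = λ { l (inj₁ e) → inj₁ e ; l (inj₂ (p , u)) → inj₂ (there p , u) }
      from : ∀ l → FoldSupport U l0 (l' ∷ ls) l → FoldSupport U l0 ls l
      from = λ { l (inj₁ e) → inj₁ e ; l (inj₂ (there p , u)) → inj₂ (p , u)
               ; l (inj₂ (here refl , u)) → contradiction (trans (sym u) Ul') λ () }

  proj-isLub : ∀ {d s} (v : Fin s → Pt d) (U : Fin s → Bool) {l0} x i → U l0 ≡ true →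
    IsLub (λ l → U l ≡ true) (λ l → projCoeff v x l + v l i) (proj v U l0 x i)
  proj-isLub {s = s} v U x i Ul0 = IsLub-resp-⇔ to from (proj-foldr-isLub v U _ x i (allFin s))
    where
      to : ∀ l → FoldSupport U _ (allFin s) l → U l ≡ true
      to = λ { l (inj₁ refl) → Ul0 ; l (inj₂ (_ , u)) → u }
      from : ∀ l → U l ≡ true → FoldSupport U _ (allFin s) l
      from l u = inj₂ (∈-allFin l , u)

  ΓCoeff : ∀ {d s} → (Fin s → Pt d) → (Fin s → Bool) → (Fin 2 → R) → Pt d → Fin s → R
  ΓCoeff v U e x l = (if U l then e zero else e (suc zero)) + projCoeff v x l

  Γ-proj-isLub : ∀ {d s} (v : Fin s → Pt d) (U : Fin s → Bool) {l0 l1} e x i →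
    U l0 ≡ true → U l1 ≡ false →
    IsLub (λ _ → ⊤) (λ l → ΓCoeff v U e x l + v l i)
          (tcomb e (pair (proj v U l0 x) (proj v (not ∘ U) l1 x)) i)
  Γ-proj-isLub v U e x i Ul0 Ul1 =
    IsLub-resp-⇔ (λ _ _ → tt) split
      (IsLub-max (IsLub-cong inU  (IsLub-+ˡ (e zero)       (proj-isLub v U x i Ul0)))
                 (IsLub-cong outU (IsLub-+ˡ (e (suc zero)) (proj-isLub v (not ∘ U) x i (cong not Ul1)))))
    where
      split : ∀ l → ⊤ → U l ≡ true ⊎ not (U l) ≡ true
      split l _ with U l
      ... | true  = inj₁ refl
      ... | false = inj₂ refl
      inU : ∀ l → U l ≡ true → e zero + (projCoeff v x l + v l i) ≡ ΓCoeff v U e x l + v l i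
      inU l Ul rewrite Ul = sym (+-assoc _ _ _)
      outU : ∀ l → not (U l) ≡ true →
             e (suc zero) + (projCoeff v x l + v l i) ≡ ΓCoeff v U e x l + v l i
      outU l ¬Ul with U l
      ... | false = sym (+-assoc _ _ _)

  admissible⇒inTconv : ∀ {d n} (v : Fin (suc n) → Pt d) {x y} → Admissible v x y → InTconv v y
  admissible⇒inTconv v {x} {y} (U , _ , _ , Ul0 , Ul1 , e , c , y≡) =
    ΓCoeff v U e x , c ,
    λ i → trans (y≡ i)
      (cong (_+ c) (IsLub-unique (Γ-proj-isLub v U e x i Ul0 Ul1) (tcomb-isLub _ v i)))

  move : ∀ {d k} {v : Fin (suc (suc k)) → Pt d} {x y w} → Admissible v x y → Path v y w → Path v x w
  move {v = v} adm = step adm (admissible⇒inTconv v adm)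

  module Sweep {d k} (v : Fin (suc (suc k)) → Pt d) (T : Fin (suc (suc k)) → R) where

    z : Pt d
    z = tcomb T v

    Below : Pt d → Set
    Below x = ∀ i → x i ≤ z i

    Covers : Pt d → Fin (suc (suc k)) → Set
    Covers x m = ∀ i → T m + v m i ≤ x i

    singleton : Fin (suc (suc k)) → Fin (suc (suc k)) → Bool
    singleton j l = does (l ≟ j)

    other : Fin (suc (suc k)) → Fin (suc (suc k))
    other zero    = suc zero
    other (suc _) = zero

    other-≢ : ∀ j → ¬ other j ≡ j
    other-≢ zero    ()
    other-≢ (suc _) ()

    -- π_tconv({v j})(x) = projCoeff v x j ⊙ v j, so with these coefficients
    -- next x j = T j ⊙ v j ⊕ ⨁_{l ≠ j} projCoeff v x l ⊙ v l.
    nextCoeffs : Pt d → Fin (suc (suc k)) → Fin 2 → R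
    nextCoeffs x j zero    = T j + - projCoeff v x j
    nextCoeffs x j (suc _) = 0r

    next : Pt d → Fin (suc (suc k)) → Pt d
    next x j = tcomb (nextCoeffs x j)
                 (pair (proj v (singleton j) j x) (proj v (not ∘ singleton j) (other j) x))

    next-admissible : ∀ x j {y} → y ~ next x j → Admissible v x y
    next-admissible x j y~next =
      singleton j , j , other j , dec-true (j ≟ j) refl , dec-false (other j ≟ j) (other-≢ j) ,
      nextCoeffs x j , y~next

    nextCoeff : Pt d → Fin (suc (suc k)) → Fin (suc (suc k)) → R
    nextCoeff x j = ΓCoeff v (singleton j) (nextCoeffs x j) x

    next-isLub : ∀ x j i → IsLub (λ _ → ⊤) (λ l → nextCoeff x j l + v l i) (next x j i)
    next-isLub x j i = Γ-proj-isLub v (singleton j) (nextCoeffs x j) x i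
                         (dec-true (j ≟ j) refl) (dec-false (other j ≟ j) (other-≢ j))

    nextCoeff-self : ∀ x j → nextCoeff x j j ≡ T j
    nextCoeff-self x j rewrite dec-true (j ≟ j) refl = //-rightDividesˡ (projCoeff v x j) (T j)

    nextCoeff-other : ∀ x j {l} → ¬ l ≡ j → nextCoeff x j l ≡ projCoeff v x l
    nextCoeff-other x j {l} l≢j rewrite dec-false (l ≟ j) l≢j = +-identityˡ (projCoeff v x l)

    next-covers-self : ∀ x j → Covers (next x j) j
    next-covers-self x j i =
      subst (λ c → c + v j i ≤ next x j i) (nextCoeff-self x j) (upper (next-isLub x j i) j tt)

    next-covers : ∀ x j {m} → Covers x m → Covers (next x j) m
    next-covers x j {m} x-covers i with m ≟ j
    ... | yes refl = next-covers-self x j i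
    ... | no  m≢j  = ≤-trans (+-mono-≤ (v m i) (≤-projCoeff v x m x-covers))
                       (subst (λ c → c + v m i ≤ next x j i) (nextCoeff-other x j m≢j)
                              (upper (next-isLub x j i) m tt))

    next-below : ∀ x j → Below x → Below (next x j)
    next-below x j x-below i = least (next-isLub x j i) (z i) bound
      where
        bound : ∀ l → ⊤ → nextCoeff x j l + v l i ≤ z i
        bound l _ = case l ≟ j of λ
          { (yes refl) → subst (λ c → c + v l i ≤ z i) (sym (nextCoeff-self x l))
                           (upper (tcomb-isLub T v i) l tt)
          ; (no l≢j)   → subst (λ c → c + v l i ≤ z i) (sym (nextCoeff-other x j l≢j))
                           (≤-trans (projCoeff-+-≤ v x l i) (x-below i))
          }

    below-covering⇒≡z : ∀ y → Below y → (∀ m → Covers y m) → ∀ i → y i ≡ z i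
    below-covering⇒≡z y y-below y-covers i =
      antisym (y-below i) (least (tcomb-isLub T v i) (y i) (λ m _ → y-covers m i))

    Pending : List (Fin (suc (suc k))) → Pt d → Set
    Pending js x = ∀ m → m ∈ js ⊎ Covers x m

    next-pending : ∀ x j js → Pending (j ∷ js) x → Pending js (next x j)
    next-pending x j js x-pending m with x-pending m
    ... | inj₁ (here refl) = inj₂ (next-covers-self x m)
    ... | inj₁ (there m∈js) = inj₁ m∈js
    ... | inj₂ x-covers = inj₂ (next-covers x j x-covers)

    sweep : ∀ w → w ~ z → ∀ j js x → Below x → Pending (j ∷ js) x → Path v x w
    sweep w (c , w≡) j [] x x-below x-pending = move (next-admissible x j (c , w≡next)) done
      where
        y-covers : ∀ m → Covers (next x j) m
        y-covers m with next-pending x j [] x-pending m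
        ... | inj₂ y-covers = y-covers
        w≡next : ∀ i → w i ≡ next x j i + c
        w≡next i = trans (w≡ i)
          (cong (_+ c) (sym (below-covering⇒≡z (next x j) (next-below x j x-below) y-covers i)))
    sweep w w~z j (j' ∷ js) x x-below x-pending =
      move (next-admissible x j (0r , λ i → sym (+-identityʳ _)))
           (sweep w w~z j' js (next x j) (next-below x j x-below) (next-pending x j (j' ∷ js) x-pending))

    path-from-below : ∀ x w → Below x → w ~ z → Path v x w
    path-from-below x w x-below w~z = sweep w w~z zero _ x x-below (λ m → inj₁ (∈-allFin m))

  below-rescaling : ∀ {d n} (a : Fin (suc n) → R) (v : Fin (suc n) → Pt d) (u w : Pt d) →
    w ~ tcomb a v →
    Σ (Fin (suc n) → R) λ T → (∀ i → u i ≤ tcomb T v i) × w ~ tcomb T v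
  below-rescaling {d} a v u w (c , w≡) = (λ l → D + a l) , u-below , (- D + c , w≡z)
    where
      W : Pt d
      W = tcomb a v
      D : R
      D = maxF (u -ᵖ W)
      u-below : ∀ i → u i ≤ tcomb (λ l → D + a l) v i
      u-below i = begin
        u i                 ≡⟨ //-rightDividesˡ (W i) (u i) ⟨
        (u i + - W i) + W i ≤⟨ +-mono-≤ (W i) (≤-maxF (u -ᵖ W) i) ⟩
        D + W i             ≡⟨ tcomb-⊙ D a v i ⟨
        tcomb (λ l → D + a l) v i ∎
        where open ≤-Reasoning
      w≡z : ∀ i → w i ≡ tcomb (λ l → D + a l) v i + (- D + c)
      w≡z i = begin
        w i                        ≡⟨ w≡ i ⟩
        W i + c                    ≡⟨ cong (W i +_) (\\-leftDividesˡ D c) ⟨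
        W i + (D + (- D + c))      ≡⟨ +-assoc (W i) D _ ⟨
        (W i + D) + (- D + c)      ≡⟨ cong (_+ (- D + c)) (+-comm (W i) D) ⟩
        (D + W i) + (- D + c)      ≡⟨ cong (_+ (- D + c)) (tcomb-⊙ D a v i) ⟨
        tcomb (λ l → D + a l) v i + (- D + c) ∎
        where open ≡-Reasoning

proposition3p23 : (ℝ : RealLine) → let open Tropical ℝ in
    (d k : ℕ) (v : Fin (suc (suc k)) → Pt d) →
    (∀ i j → v i ~ v j → i ≡ j) →
    (u w : Pt d) → InTconv v u → InTconv v w → Path v u w
proposition3p23 ℝ d k v _ u w _ (a , w~W) with below-rescaling ℝ a v u w w~W
... | T , u-below , w~z = Sweep.path-from-below ℝ v T u w u-below w~z
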